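{- The multiple-conclusion Hilbert systems $\mathsf{R}_{\mathrm{BK}}$ and $\mathsf{R}_{\mathrm{BK}\star}$ below induce the same Set-Set logic: $\rhd_{\mathsf{R}_{\mathrm{BK}}}=\rhd_{\mathsf{R}_{\mathrm{BK}\star}}$.
   Context: Formulas are built from a countably infinite set of variables with binary $\land,\lor$ and unary $\neg$. A Set-Set Hilbert system is a set of rule schemas $\Pi/\Sigma$ ($\Pi,\Sigma$ finite, possibly empty) with all substitution instances as rules. A derivation is a finite rooted tree with nodes labelled by sets of formulas or by $\star$: a non-leaf node labelled $\Lambda$ either has a single child labelled $\star$, provided some rule instance $\Pi/\varnothing$ has $\Pi\subseteq\Lambda$, or has children labelled $\Lambda\cup\{\psi_1\},\dots,\Lambda\cup\{\psi_m\}$ for some rule instance $\Pi/\{\psi_1,\dots,\psi_m\}$ ($m\ge1$) with $\Pi\subseteq\Lambda$. A proof of $(\Gamma,\Delta)$ is a derivation with root labelled by a subset of $\Gamma$ and every leaf labelled $\star$ or by a set meeting $\Delta$; $\Gamma\rhd_{\mathsf R}\Delta$ iff such a proof exists. $\mathsf{R}_{\mathrm{BK}}$ has rule schemas: (1) $p,\neg p/\varnothing$; (2) $p/\neg\neg p$; (3) $\neg\neg p/p$; (4) $p,q/p\land q$; (5) $\neg p,\neg q/\neg(p\land q)$; (6) $\neg p,q/\neg(p\land q)$; (7) $p,\neg q/\neg(p\land q)$; (8) $\neg(p\land q)/\neg p,p$; (9) $\neg(p\land q)/\neg q,q$; (10) $p\land q/p$; (11) $p\land q/q$; (12) $\neg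 p,\neg q/\neg(p\lor q)$; (13) $\neg(p\lor q)/\neg p$; (14) $\neg(p\lor q)/\neg q$; (15) $p\lor q/p,\neg p$; (16) $p\lor q/q,\neg q$; (17) $\neg p,q/p\lor q$; (18) $p,\neg q/p\lor q$; (19) $p,q/p\lor q$; (20) $p\lor q/p,q$. $\mathsf{R}_{\mathrm{BK}\star}$ is obtained from $\mathsf{R}_{\mathrm{BK}}$ by replacing (8) with $\neg(p\land q)/\neg p\lor p$, (9) with $\neg(p\land q)/\neg q\lor q$, (15) with $p\lor q/p\lor\neg p$, and (16) with $p\lor q/q\lor\neg q$. -}

module Defs where

open import Level using (0ℓ)
open import Data.Nat using (ℕ)
open import Data.List using (List; []; _∷_; map)
open import Data.List.Membership.Propositional using (_∈_)
open import Data.List.Relation.Unary.All using (All)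
open import Data.Product using (Σ; _×_; _,_)
open import Data.Sum using (_⊎_)
open import Relation.Binary.PropositionalEquality using (_≡_; _≢_)
open import Relation.Unary using (Pred; _⊆_)

data Formula : Set where
  var : ℕ → Formula
  _∧'_ : Formula → Formula → Formula
  _∨'_ : Formula → Formula → Formula
  ¬'_ : Formula → Formula

infixr 8 _∧'_
infixr 7 _∨'_
infix 9 ¬'_

Subst : Set
Subst = ℕ → Formula

sub : Subst → Formula → Formula
sub σ (var n) = σ n
sub σ (φ ∧' ψ) = sub σ φ ∧' sub σ ψ
sub σ (φ ∨' ψ) = sub σ φ ∨' sub σ ψ
sub σ (¬' φ) = ¬' sub σ φ

record RuleSchema : Set where
  constructor _/_
  field
    prem  : List Formula
    concl : List Formula
open RuleSchema public

-- A Set-Set Hilbert system: a (finite) list of rule schemas; its rules are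
-- all substitution instances of these schemas.
System : Set
System = List RuleSchema

FSet : Set₁
FSet = Pred Formula 0ℓ

_∪｛_｝ : FSet → Formula → FSet
(Λ ∪｛ ψ ｝) x = Λ x ⊎ x ≡ ψ

AllIn : FSet → List Formula → Set
AllIn Λ xs = All Λ xs

-- Proof R Δ Λ : a derivation (in R) whose root is labelled Λ and all of
-- whose leaves are labelled ⋆ or by a set meeting Δ.
data Proof (R : System) (Δ : FSet) : FSet → Set₁ where
  leaf   : ∀ {Λ} (φ : Formula) → Λ φ → Δ φ → Proof R Δ Λ
  star   : ∀ {Λ} (r : RuleSchema) → r ∈ R → (σ : Subst) →
           concl r ≡ [] → AllIn Λ (map (sub σ) (prem r)) → Proof R Δ Λ
  branch : ∀ {Λ} (r : RuleSchema) → r ∈ R → (σ : Subst) →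
           concl r ≢ [] → AllIn Λ (map (sub σ) (prem r)) →
           All (λ ψ → Proof R Δ (Λ ∪｛ ψ ｝)) (map (sub σ) (concl r)) →
           Proof R Δ Λ

_▷[_]_ : FSet → System → FSet → Set₁
Γ ▷[ R ] Δ = Σ FSet (λ Λ → (Λ ⊆ Γ) × Proof R Δ Λ)

p q : Formula
p = var 0
q = var 1

common : System
common =
    ((p ∷ ¬' p ∷ []) / [])                                  -- (1)
  ∷ ((p ∷ []) / (¬' ¬' p ∷ []))                            -- (2)
  ∷ ((¬' ¬' p ∷ []) / (p ∷ []))                            -- (3)
  ∷ ((p ∷ q ∷ []) / (p ∧' q ∷ []))                         -- (4)
  ∷ ((¬' p ∷ ¬' q ∷ []) / (¬' (p ∧' q) ∷ []))              -- (5)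
  ∷ ((¬' p ∷ q ∷ []) / (¬' (p ∧' q) ∷ []))                 -- (6)
  ∷ ((p ∷ ¬' q ∷ []) / (¬' (p ∧' q) ∷ []))                 -- (7)
  ∷ ((p ∧' q ∷ []) / (p ∷ []))                             -- (10)
  ∷ ((p ∧' q ∷ []) / (q ∷ []))                             -- (11)
  ∷ ((¬' p ∷ ¬' q ∷ []) / (¬' (p ∨' q) ∷ []))              -- (12)
  ∷ ((¬' (p ∨' q) ∷ []) / (¬' p ∷ []))                     -- (13)
  ∷ ((¬' (p ∨' q) ∷ []) / (¬' q ∷ []))                     -- (14)
  ∷ ((¬' p ∷ q ∷ []) / (p ∨' q ∷ []))                      -- (17)
  ∷ ((p ∷ ¬' q ∷ []) / (p ∨' q ∷ []))                      -- (18)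
  ∷ ((p ∷ q ∷ []) / (p ∨' q ∷ []))                         -- (19)
  ∷ ((p ∨' q ∷ []) / (p ∷ q ∷ []))                         -- (20)
  ∷ []

R-BK : System
R-BK =
    ((¬' (p ∧' q) ∷ []) / (¬' p ∷ p ∷ []))                 -- (8)
  ∷ ((¬' (p ∧' q) ∷ []) / (¬' q ∷ q ∷ []))                 -- (9)
  ∷ ((p ∨' q ∷ []) / (p ∷ ¬' p ∷ []))                      -- (15)
  ∷ ((p ∨' q ∷ []) / (q ∷ ¬' q ∷ []))                      -- (16)
  ∷ common

R-BK⋆ : System
R-BK⋆ =
    ((¬' (p ∧' q) ∷ []) / (¬' p ∨' p ∷ []))                -- (8⋆)
  ∷ ((¬' (p ∧' q) ∷ []) / (¬' q ∨' q ∷ []))                -- (9⋆)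
  ∷ ((p ∨' q ∷ []) / (p ∨' ¬' p ∷ []))                     -- (15⋆)
  ∷ ((p ∨' q ∷ []) / (q ∨' ¬' q ∷ []))                     -- (16⋆)
  ∷ common

-- Every rule of each system is derivable in the other. A rule Π / φ, ψ of
-- R_BK follows from its starred version Π / φ ∨ ψ by splitting the
-- disjunction with (20); conversely ¬A ∨ A and A ∨ ¬A follow from each of A
-- and ¬A by (17) or (18), after passing from A to ¬¬A by (2). Since a
-- derivable rule can be replaced by its derivation, grafted into any proof
-- where the rule is used, the two consequence relations coincide.
module Submission where

open import Defs
open import Data.Fin using (#_)
open import Data.List using (List; []; _∷_; map)
open import Data.List.Membership.Propositional using (_∈_)
open import Data.List.Membership.Propositional.Properties using (∈-lookup)
open import Data.List.Relation.Unary.All as All using (All; []; _∷_)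
open import Data.List.Relation.Unary.Any using (here; there)
open import Data.Nat using (zero; suc)
open import Data.Product using (_×_; _,_)
open import Data.Sum as Sum using (inj₁; inj₂)
open import Relation.Binary.PropositionalEquality using (refl)
open import Relation.Unary using (_⊆_)

private
  variable
    R R′ : System
    Γ Δ Σ Λ Θ : FSet
    A B : Formula
    xs : List Formula

⟦_⟧ : List Formula → FSet
⟦ xs ⟧ = _∈ xs

pq≔ : Formula → Formula → Subst
pq≔ A B zero    = A
pq≔ A B (suc _) = B

mutual
  weaken : Λ ⊆ Θ → Proof R Δ Λ → Proof R Δ Θ
  weaken Λ⊆Θ (leaf φ φ∈Λ φ∈Δ) = leaf φ (Λ⊆Θ φ∈Λ) φ∈Δ
  weaken Λ⊆Θ (star r r∈R σ e prems) = star r r∈R σ e (All.map Λ⊆Θ prems)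
  weaken Λ⊆Θ (branch r r∈R σ e prems children) =
    branch r r∈R σ e (All.map Λ⊆Θ prems) (weaken-children Λ⊆Θ children)

  weaken-children : Λ ⊆ Θ →
    All (λ ψ → Proof R Δ (Λ ∪｛ ψ ｝)) xs → All (λ ψ → Proof R Δ (Θ ∪｛ ψ ｝)) xs
  weaken-children Λ⊆Θ []       = []
  weaken-children Λ⊆Θ (c ∷ cs) = weaken (Sum.map₁ Λ⊆Θ) c ∷ weaken-children Λ⊆Θ cs

-- Λ ⊆ Θ is the invariant that the root label Λ survives at every node, so the
-- continuation for a leaf meeting Σ in φ can be weakened into that leaf.
mutual
  graft : Λ ⊆ Θ → Proof R Σ Θ → (∀ {φ} → Σ φ → Proof R Δ (Λ ∪｛ φ ｝)) → Proof R Δ Θ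
  graft Λ⊆Θ (leaf φ φ∈Θ φ∈Σ) k = weaken Sum.[ Λ⊆Θ , (λ { refl → φ∈Θ }) ] (k φ∈Σ)
  graft Λ⊆Θ (star r r∈R σ e prems) k = star r r∈R σ e prems
  graft Λ⊆Θ (branch r r∈R σ e prems children) k =
    branch r r∈R σ e prems (graft-children Λ⊆Θ children k)

  graft-children : Λ ⊆ Θ → All (λ ψ → Proof R Σ (Θ ∪｛ ψ ｝)) xs →
    (∀ {φ} → Σ φ → Proof R Δ (Λ ∪｛ φ ｝)) → All (λ ψ → Proof R Δ (Θ ∪｛ ψ ｝)) xs
  graft-children Λ⊆Θ []       k = []
  graft-children Λ⊆Θ (c ∷ cs) k = graft (λ x → inj₁ (Λ⊆Θ x)) c k ∷ graft-children Λ⊆Θ cs k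

cut : Proof R ⟦ xs ⟧ Λ → All (λ φ → Proof R Δ (Λ ∪｛ φ ｝)) xs → Proof R Δ Λ
cut P ks = graft (λ x → x) P (All.lookup ks)

cut₁ : Proof R ⟦ A ∷ [] ⟧ Λ → Proof R Δ (Λ ∪｛ A ｝) → Proof R Δ Λ
cut₁ P k = cut P (k ∷ [])

Derivable : System → RuleSchema → Set₁
Derivable R r = ∀ σ → Proof R ⟦ map (sub σ) (concl r) ⟧ ⟦ map (sub σ) (prem r) ⟧

self-derivable : ∀ {r} → r ∈ R → Derivable R r
self-derivable {r = _ / []}      r∈R σ = star _ r∈R σ refl (All.tabulate (λ x → x))
self-derivable {r = _ / (_ ∷ _)} r∈R σ =
  branch _ r∈R σ (λ ()) (All.tabulate (λ x → x)) (All.tabulate (λ ψ∈ → leaf _ (inj₂ refl) ψ∈))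

by-rule : ∀ {r} → r ∈ R → ∀ σ → AllIn Λ (map (sub σ) (prem r)) →
  Proof R ⟦ map (sub σ) (concl r) ⟧ Λ
by-rule r∈R σ prems = weaken (All.lookup prems) (self-derivable r∈R σ)

apply-derivable : ∀ {r} → Derivable R r → ∀ σ → AllIn Λ (map (sub σ) (prem r)) →
  All (λ ψ → Proof R Δ (Λ ∪｛ ψ ｝)) (map (sub σ) (concl r)) → Proof R Δ Λ
apply-derivable D σ prems = cut (weaken (All.lookup prems) (D σ))

mutual
  simulate : (∀ {r} → r ∈ R → Derivable R′ r) → Proof R Δ Λ → Proof R′ Δ Λ
  simulate D (leaf φ φ∈Λ φ∈Δ) = leaf φ φ∈Λ φ∈Δ
  simulate D (star (Π / .[]) r∈R σ refl prems) = apply-derivable (D r∈R) σ prems []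
  simulate D (branch r r∈R σ e prems children) =
    apply-derivable (D r∈R) σ prems (simulate-children D children)

  simulate-children : (∀ {r} → r ∈ R → Derivable R′ r) →
    All (λ ψ → Proof R Δ (Λ ∪｛ ψ ｝)) xs → All (λ ψ → Proof R′ Δ (Λ ∪｛ ψ ｝)) xs
  simulate-children D []       = []
  simulate-children D (c ∷ cs) = simulate D c ∷ simulate-children D cs

▷-mono-derivable : (∀ {r} → r ∈ R → Derivable R′ r) → Γ ▷[ R ] Δ → Γ ▷[ R′ ] Δ
▷-mono-derivable D (Λ , Λ⊆Γ , P) = Λ , Λ⊆Γ , simulate D P

split-∨ : ((p ∨' q ∷ []) / (p ∷ q ∷ [])) ∈ R →
  Proof R ⟦ A ∨' B ∷ [] ⟧ Λ → Proof R ⟦ A ∷ B ∷ [] ⟧ Λ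
split-∨ {A = A} {B} rule₂₀ P = cut₁ P (by-rule rule₂₀ (pq≔ A B) (inj₂ refl ∷ []))

common-⊆ : ∀ {r a b c d} → r ∈ common → r ∈ (a ∷ b ∷ c ∷ d ∷ common)
common-⊆ r∈ = there (there (there (there r∈)))

rule₂ : ((p ∷ []) / (¬' ¬' p ∷ [])) ∈ R-BK
rule₂ = common-⊆ (∈-lookup (# 1))

rule₁₇ : ((¬' p ∷ q ∷ []) / (p ∨' q ∷ [])) ∈ R-BK
rule₁₇ = common-⊆ (∈-lookup (# 12))

rule₁₈ : ((p ∷ ¬' q ∷ []) / (p ∨' q ∷ [])) ∈ R-BK
rule₁₈ = common-⊆ (∈-lookup (# 13))

rule₂₀⋆ : ((p ∨' q ∷ []) / (p ∷ q ∷ [])) ∈ R-BK⋆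
rule₂₀⋆ = common-⊆ (∈-lookup (# 15))

¬A⊢¬A∨A : Proof R-BK ⟦ ¬' A ∨' A ∷ [] ⟧ (Λ ∪｛ ¬' A ｝)
¬A⊢¬A∨A {A = A} = by-rule rule₁₈ (pq≔ (¬' A) A) (inj₂ refl ∷ inj₂ refl ∷ [])

¬A⊢A∨¬A : Proof R-BK ⟦ A ∨' ¬' A ∷ [] ⟧ (Λ ∪｛ ¬' A ｝)
¬A⊢A∨¬A {A = A} = by-rule rule₁₇ (pq≔ A (¬' A)) (inj₂ refl ∷ inj₂ refl ∷ [])

A⊢¬¬A : Proof R-BK ⟦ ¬' ¬' A ∷ [] ⟧ (Λ ∪｛ A ｝)
A⊢¬¬A {A = A} = by-rule rule₂ (pq≔ A A) (inj₂ refl ∷ [])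

A⊢¬A∨A : Proof R-BK ⟦ ¬' A ∨' A ∷ [] ⟧ (Λ ∪｛ A ｝)
A⊢¬A∨A {A = A} =
  cut₁ A⊢¬¬A (by-rule rule₁₇ (pq≔ (¬' A) A) (inj₂ refl ∷ inj₁ (inj₂ refl) ∷ []))

A⊢A∨¬A : Proof R-BK ⟦ A ∨' ¬' A ∷ [] ⟧ (Λ ∪｛ A ｝)
A⊢A∨¬A {A = A} =
  cut₁ A⊢¬¬A (by-rule rule₁₈ (pq≔ A (¬' A)) (inj₁ (inj₂ refl) ∷ inj₂ refl ∷ []))

-- (8), (9), (15), (16) and their starred versions occupy positions 0–3 of the
-- two systems, so ∈-lookup (# i) picks the counterpart in the other system.
R-BK-derivable-in-R-BK⋆ : ∀ {r} → r ∈ R-BK → Derivable R-BK⋆ r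
R-BK-derivable-in-R-BK⋆ (here refl) σ =
  split-∨ rule₂₀⋆ (self-derivable (∈-lookup (# 0)) σ)
R-BK-derivable-in-R-BK⋆ (there (here refl)) σ =
  split-∨ rule₂₀⋆ (self-derivable (∈-lookup (# 1)) σ)
R-BK-derivable-in-R-BK⋆ (there (there (here refl))) σ =
  split-∨ rule₂₀⋆ (self-derivable (∈-lookup (# 2)) σ)
R-BK-derivable-in-R-BK⋆ (there (there (there (here refl)))) σ =
  split-∨ rule₂₀⋆ (self-derivable (∈-lookup (# 3)) σ)
R-BK-derivable-in-R-BK⋆ (there (there (there (there r∈)))) = self-derivable (common-⊆ r∈)

R-BK⋆-derivable-in-R-BK : ∀ {r} → r ∈ R-BK⋆ → Derivable R-BK r
R-BK⋆-derivable-in-R-BK (here refl) σ =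
  cut (self-derivable (∈-lookup (# 0)) σ) (¬A⊢¬A∨A ∷ A⊢¬A∨A ∷ [])
R-BK⋆-derivable-in-R-BK (there (here refl)) σ =
  cut (self-derivable (∈-lookup (# 1)) σ) (¬A⊢¬A∨A ∷ A⊢¬A∨A ∷ [])
R-BK⋆-derivable-in-R-BK (there (there (here refl))) σ =
  cut (self-derivable (∈-lookup (# 2)) σ) (A⊢A∨¬A ∷ ¬A⊢A∨¬A ∷ [])
R-BK⋆-derivable-in-R-BK (there (there (there (here refl)))) σ =
  cut (self-derivable (∈-lookup (# 3)) σ) (A⊢A∨¬A ∷ ¬A⊢A∨¬A ∷ [])
R-BK⋆-derivable-in-R-BK (there (there (there (there r∈)))) = self-derivable (common-⊆ r∈)

proposition4 : (Γ Δ : FSet) →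
    ((Γ ▷[ R-BK ] Δ → Γ ▷[ R-BK⋆ ] Δ) × (Γ ▷[ R-BK⋆ ] Δ → Γ ▷[ R-BK ] Δ))
proposition4 Γ Δ =
  ▷-mono-derivable R-BK-derivable-in-R-BK⋆ , ▷-mono-derivable R-BK⋆-derivable-in-R-BK
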